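{- Define $a(1)=1$ and $a(n)=1+\sum_m a(m)$ for $n>1$, the sum over all proper divisors $m$ of $n$ (positive divisors $m<n$). Let $p,q,r$ be distinct primes and $c,d,e$ nonnegative integers. Then $$a(p^c)=2^c,\qquad a(p^cq^d)=2^c\sum_{i=0}^{d}\binom{d}{i}\binom{c+i}{i},$$ $$a(p^cq^dr^e)=\sum_{j=0}^{d}(-1)^j\binom{d}{j}\binom{c+d-j}{d}\,a(p^{c+d-j}r^e).$$
   Context: $a(n)$ is called the number of recursive divisors of $n$. -}

module Defs where

open import Data.Nat using (ℕ; zero; suc; _+_; _∸_; _<ᵇ_)
open import Data.Nat.Divisibility using (_∣?_)
open import Data.Nat.ListAction using (sum)
open import Data.List using (List; []; _∷_; map; filter; upTo; foldr)
open import Data.Bool using (if_then_else_)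
open import Data.Integer as ℤ using (ℤ)
open import Data.Nat.Combinatorics using (_C_)

properDivisors : ℕ → List ℕ
properDivisors n = filter (_∣? n) (map suc (upTo (n ∸ 1)))

-- Each recursive call is on a strictly smaller argument, so fuel n suffices
-- for computing a(n); we set a n = aFuel n n.  (a 0 = 1 is a junk value;
-- the theorem only uses positive arguments.)
aFuel : ℕ → ℕ → ℕ
aFuel zero    n = 1
aFuel (suc f) n = if 1 <ᵇ n then 1 + sum (map (aFuel f) (properDivisors n)) else 1

a : ℕ → ℕ
a n = aFuel n n

sumTo : ℕ → (ℕ → ℕ) → ℕ
sumTo d f = sum (map f (upTo (suc d)))

sumToℤ : ℕ → (ℕ → ℤ) → ℤ
sumToℤ d f = foldr ℤ._+_ (ℤ.+ 0) (map f (upTo (suc d)))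

sign : ℕ → ℤ
sign zero = ℤ.+ 1
sign (suc j) = ℤ.- sign j

-- Since a(N) = 1 + Σ_{m ∣ N, m < N} a(m), we have 2 a(N) = 1 + Σ_{m ∣ N} a(m). For N = p^c q^d r^e the
-- divisors are the p^i q^j r^k with i ≤ c, j ≤ d, k ≤ e, so A(c,d,e) = a(p^c q^d r^e) satisfies
-- 2 A = 1 + (sum of A over the box below (c,d,e)); taking backward differences in all three exponents
-- turns this into 2 Δ₃ A = A + δ₃, with δ₃ the indicator of the origin. Such an equation has at most
-- one solution (induct on one variable at a time), in two variables as well as in three, so it suffices
-- to check that the claimed formulas solve it. For two primes this is a Pascal-type recurrence of the
-- binomial sums. For three primes the right-hand side is T G (c, d) with G m = A(m,0,e), and
-- T G (c, d) = Δᵈ (n ↦ C(n+d,d) G(n+d)) at c; the product rule for this weight gives Δ₂ ∘ T = T ∘ Δ,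
-- so T turns the two-variable solution (m, e) ↦ A(m,0,e) into a solution of the three-variable equation.

module Submission where

open import Algebra.Structures using (IsMonoid)
open import Data.Bool using (if_then_else_)
open import Data.Empty using (⊥-elim)
open import Data.Integer as ℤ using (ℤ)
open import Data.Integer using () renaming (_+_ to _⊕_; _*_ to _⊛_; -_ to ⊝_; _-_ to _⊖_; +_ to pos)
import Data.Integer.Properties as ℤP
open import Data.Integer.Tactic.RingSolver using (solve-∀)
open import Data.List using (List; []; _∷_; map; upTo; foldr; filter; _++_; [_]; cartesianProduct)
import Data.List.Properties as LP
open import Data.List.Membership.Propositional using (_∈_)
open import Data.List.Membership.Propositional.Properties
  using (∈-filter⁻; ∈-filter⁺; ∈-map⁻; ∈-map⁺; ∈-upTo⁺; ∈-upTo⁻; ∈-cartesianProduct⁻; ∈-cartesianProduct⁺)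
open import Data.List.Membership.Propositional.Properties.WithK using (unique∧set⇒bag)
open import Data.List.Relation.Binary.BagAndSetEquality using (∼bag⇒↭)
import Data.List.Relation.Binary.Permutation.Propositional.Properties as PermP
import Data.List.Relation.Unary.All as All
import Data.List.Relation.Unary.All.Properties as AllP
open import Data.List.Relation.Unary.AllPairs using ([]; _∷_)
open import Data.List.Relation.Unary.Any using (here; there)
open import Data.List.Relation.Unary.Unique.Propositional using (Unique)
import Data.List.Relation.Unary.Unique.Propositional.Properties as UniqueP
open import Data.Nat as ℕ using (ℕ; zero; suc; _+_; _*_; _∸_; _^_; _≤_; _<_; z≤n; s≤s; NonZero; _<ᵇ_)
import Data.Nat.Properties as ℕP
open import Data.Nat.Combinatorics using (_C_; nCn≡1; k>n⇒nCk≡0; nCk+nC[k+1]≡[n+1]C[k+1])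
open import Data.Nat.Coprimality using (Coprime; coprime-divisor)
open import Data.Nat.Divisibility
open import Data.Nat.ListAction using (sum)
import Data.Nat.ListAction.Properties as ℕLP
open import Data.Nat.Primality using (Prime; prime⇒nonZero; prime⇒nonTrivial; prime⇒irreducible; euclidsLemma)
open import Data.Product using (_×_; _,_; proj₁; proj₂; uncurry; Σ-syntax)
open import Data.Sum using (inj₁; inj₂)
open import Data.Unit using (⊤; tt)
open import Function.Base using (_∘_)
open import Function.Bundles using (mk⇔)
open import Relation.Nullary using (¬_; yes; no)
open import Relation.Binary.PropositionalEquality
  using (_≡_; _≢_; refl; sym; trans; cong; cong₂; subst; subst₂; module ≡-Reasoning)

open import Defs

-- Finite sums

module _ {A : Set} {_∙_ : A → A → A} {ε : A} (isMonoid : IsMonoid _≡_ _∙_ ε) where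
  open IsMonoid isMonoid using (assoc; identityˡ; identityʳ)

  foldr-from : ∀ x xs → foldr _∙_ x xs ≡ foldr _∙_ ε xs ∙ x
  foldr-from x []       = sym (identityˡ x)
  foldr-from x (y ∷ ys) = trans (cong (y ∙_) (foldr-from x ys)) (sym (assoc y _ x))

  foldr-map-upTo-suc : ∀ (f : ℕ → A) n →
                       foldr _∙_ ε (map f (upTo (suc n))) ≡ foldr _∙_ ε (map f (upTo n)) ∙ f n
  foldr-map-upTo-suc f n = begin
    foldr _∙_ ε (map f (upTo (suc n)))        ≡⟨ cong (foldr _∙_ ε ∘ map f) (sym (LP.upTo-∷ʳ n)) ⟩
    foldr _∙_ ε (map f (upTo n ++ [ n ]))      ≡⟨ cong (foldr _∙_ ε) (LP.map-++ f (upTo n) [ n ]) ⟩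
    foldr _∙_ ε (map f (upTo n) ++ [ f n ])    ≡⟨ LP.foldr-++ _∙_ ε (map f (upTo n)) [ f n ] ⟩
    foldr _∙_ (f n ∙ ε) (map f (upTo n))       ≡⟨ foldr-from (f n ∙ ε) (map f (upTo n)) ⟩
    foldr _∙_ ε (map f (upTo n)) ∙ (f n ∙ ε)   ≡⟨ cong (foldr _∙_ ε (map f (upTo n)) ∙_) (identityʳ (f n)) ⟩
    foldr _∙_ ε (map f (upTo n)) ∙ f n         ∎
    where open ≡-Reasoning

sumTo-suc : ∀ d f → sumTo (suc d) f ≡ sumTo d f + f (suc d)
sumTo-suc d f = foldr-map-upTo-suc ℕP.+-0-isMonoid f (suc d)

Σℤ : ℕ → (ℕ → ℤ) → ℤ
Σℤ zero    f = f 0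
Σℤ (suc d) f = Σℤ d f ⊕ f (suc d)

sumToℤ≡Σℤ : ∀ d f → sumToℤ d f ≡ Σℤ d f
sumToℤ≡Σℤ zero    f = ℤP.+-identityʳ (f 0)
sumToℤ≡Σℤ (suc d) f = trans (foldr-map-upTo-suc ℤP.+-0-isMonoid f (suc d))
                            (cong (_⊕ f (suc d)) (sumToℤ≡Σℤ d f))

pos-sumTo : ∀ d f → pos (sumTo d f) ≡ Σℤ d (λ i → pos (f i))
pos-sumTo zero    f = cong pos (ℕP.+-identityʳ (f 0))
pos-sumTo (suc d) f = begin
  pos (sumTo (suc d) f)              ≡⟨ cong pos (sumTo-suc d f) ⟩
  pos (sumTo d f + f (suc d))        ≡⟨ ℤP.pos-+ (sumTo d f) (f (suc d)) ⟩
  pos (sumTo d f) ⊕ pos (f (suc d))  ≡⟨ cong (_⊕ pos (f (suc d))) (pos-sumTo d f) ⟩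
  Σℤ (suc d) (λ i → pos (f i))       ∎
  where open ≡-Reasoning

Σℤ-cong : ∀ d {f g} → (∀ i → f i ≡ g i) → Σℤ d f ≡ Σℤ d g
Σℤ-cong zero    eq = eq 0
Σℤ-cong (suc d) eq = cong₂ _⊕_ (Σℤ-cong d eq) (eq (suc d))

Σℤ-distrib-⊕ : ∀ d f g → Σℤ d (λ i → f i ⊕ g i) ≡ Σℤ d f ⊕ Σℤ d g
Σℤ-distrib-⊕ zero    f g = refl
Σℤ-distrib-⊕ (suc d) f g =
  trans (cong (_⊕ (f (suc d) ⊕ g (suc d))) (Σℤ-distrib-⊕ d f g)) (swap (Σℤ d f) (Σℤ d g) _ _)
  where swap : ∀ a b c e → a ⊕ b ⊕ (c ⊕ e) ≡ a ⊕ c ⊕ (b ⊕ e)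
        swap = solve-∀

Σℤ-neg : ∀ d f → Σℤ d (λ i → ⊝ f i) ≡ ⊝ Σℤ d f
Σℤ-neg zero    f = refl
Σℤ-neg (suc d) f =
  trans (cong (_⊕ ⊝ f (suc d)) (Σℤ-neg d f)) (sym (ℤP.neg-distrib-+ (Σℤ d f) (f (suc d))))

Σℤ-*ˡ : ∀ d k f → Σℤ d (λ i → k ⊛ f i) ≡ k ⊛ Σℤ d f
Σℤ-*ˡ zero    k f = refl
Σℤ-*ˡ (suc d) k f =
  trans (cong (_⊕ k ⊛ f (suc d)) (Σℤ-*ˡ d k f)) (sym (ℤP.*-distribˡ-+ k (Σℤ d f) (f (suc d))))

Σℤ-zero : ∀ d → Σℤ d (λ _ → pos 0) ≡ pos 0
Σℤ-zero zero    = refl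
Σℤ-zero (suc d) = cong (_⊕ pos 0) (Σℤ-zero d)

Σℤ-suc-head : ∀ d f → Σℤ (suc d) f ≡ f 0 ⊕ Σℤ d (f ∘ suc)
Σℤ-suc-head zero    f = refl
Σℤ-suc-head (suc d) f = trans (cong (_⊕ f (suc (suc d))) (Σℤ-suc-head d f)) (ℤP.+-assoc (f 0) _ _)

pascal : ∀ n k → pos (suc n C suc k) ≡ pos (n C k) ⊕ pos (n C suc k)
pascal n k = trans (cong pos (sym (nCk+nC[k+1]≡[n+1]C[k+1] n k))) (ℤP.pos-+ (n C k) (n C suc k))

Σℤ-pascal : ∀ d (h : ℕ → ℤ) → Σℤ (suc d) (λ j → pos (suc d C j) ⊛ h j)
                    ≡ Σℤ d (λ j → pos (d C j) ⊛ h j) ⊕ Σℤ d (λ j → pos (d C j) ⊛ h (suc j))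
Σℤ-pascal d h = begin
  Σℤ (suc d) (λ j → pos (suc d C j) ⊛ h j)
    ≡⟨ Σℤ-suc-head d (λ j → pos (suc d C j) ⊛ h j) ⟩
  pos 1 ⊛ h 0 ⊕ Σℤ d (λ j → pos (suc d C suc j) ⊛ h (suc j))
    ≡⟨ cong (pos 1 ⊛ h 0 ⊕_) (Σℤ-cong d split) ⟩
  pos 1 ⊛ h 0 ⊕ Σℤ d (λ j → L j ⊕ R j)
    ≡⟨ cong (pos 1 ⊛ h 0 ⊕_) (Σℤ-distrib-⊕ d L R) ⟩
  pos 1 ⊛ h 0 ⊕ (Σℤ d L ⊕ Σℤ d R)
    ≡⟨ regroup (pos 1 ⊛ h 0) (Σℤ d L) (Σℤ d R) ⟩
  (pos (d C 0) ⊛ h 0 ⊕ Σℤ d R) ⊕ Σℤ d L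
    ≡⟨ cong (_⊕ Σℤ d L) (sym (Σℤ-suc-head d (λ j → pos (d C j) ⊛ h j))) ⟩
  Σℤ d (λ j → pos (d C j) ⊛ h j) ⊕ pos (d C suc d) ⊛ h (suc d) ⊕ Σℤ d L
    ≡⟨ cong (λ z → Σℤ d (λ j → pos (d C j) ⊛ h j) ⊕ pos z ⊛ h (suc d) ⊕ Σℤ d L)
            (k>n⇒nCk≡0 (ℕP.n<1+n d)) ⟩
  Σℤ d (λ j → pos (d C j) ⊛ h j) ⊕ pos 0 ⊛ h (suc d) ⊕ Σℤ d L
    ≡⟨ cong (_⊕ Σℤ d L) (ℤP.+-identityʳ (Σℤ d (λ j → pos (d C j) ⊛ h j))) ⟩
  Σℤ d (λ j → pos (d C j) ⊛ h j) ⊕ Σℤ d L ∎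
  where
  open ≡-Reasoning
  L R : ℕ → ℤ
  L j = pos (d C j) ⊛ h (suc j)
  R j = pos (d C suc j) ⊛ h (suc j)
  split : ∀ j → pos (suc d C suc j) ⊛ h (suc j) ≡ L j ⊕ R j
  split j = trans (cong (_⊛ h (suc j)) (pascal d j)) (ℤP.*-distribʳ-+ (h (suc j)) (pos (d C j)) (pos (d C suc j)))
  regroup : ∀ a b c → a ⊕ (b ⊕ c) ≡ (a ⊕ c) ⊕ b
  regroup = solve-∀

-- Backward differences

-- F is extended by F (-1) = 0, which makes Δ the inverse of taking prefix sums.
Δ : (ℕ → ℤ) → ℕ → ℤ
Δ F zero    = F zero
Δ F (suc n) = F (suc n) ⊖ F n

Δ-cong : ∀ {F G} → (∀ n → F n ≡ G n) → ∀ n → Δ F n ≡ Δ G n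
Δ-cong eq zero    = eq zero
Δ-cong eq (suc n) = cong₂ _⊖_ (eq (suc n)) (eq n)

Δ-⊕ : ∀ F G n → Δ (λ m → F m ⊕ G m) n ≡ Δ F n ⊕ Δ G n
Δ-⊕ F G zero    = refl
Δ-⊕ F G (suc n) = interchange (F (suc n)) (G (suc n)) (F n) (G n)
  where interchange : ∀ a b c d → (a ⊕ b) ⊖ (c ⊕ d) ≡ (a ⊖ c) ⊕ (b ⊖ d)
        interchange = solve-∀

Δ-⊖ : ∀ F G n → Δ (λ m → F m ⊖ G m) n ≡ Δ F n ⊖ Δ G n
Δ-⊖ F G zero    = refl
Δ-⊖ F G (suc n) = interchange (F (suc n)) (G (suc n)) (F n) (G n)
  where interchange : ∀ a b c d → (a ⊖ b) ⊖ (c ⊖ d) ≡ (a ⊖ c) ⊖ (b ⊖ d)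
        interchange = solve-∀

Δ-Σℤ : ∀ d (H : ℕ → ℕ → ℤ) n → Δ (λ m → Σℤ d (λ i → H i m)) n ≡ Σℤ d (λ i → Δ (H i) n)
Δ-Σℤ zero    H n = refl
Δ-Σℤ (suc d) H n = trans (Δ-⊕ (λ m → Σℤ d (λ i → H i m)) (H (suc d)) n)
                         (cong (_⊕ Δ (H (suc d)) n) (Δ-Σℤ d H n))

Δ-Σℤ-prefix : ∀ F n → Δ (λ m → Σℤ m F) n ≡ F n
Δ-Σℤ-prefix F zero    = refl
Δ-Σℤ-prefix F (suc n) = cancel (Σℤ n F) (F (suc n))
  where cancel : ∀ s x → s ⊕ x ⊖ s ≡ x
        cancel = solve-∀

Δⁿ : ℕ → (ℕ → ℤ) → ℕ → ℤ
Δⁿ zero    F = F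
Δⁿ (suc d) F = Δ (Δⁿ d F)

Δⁿ-cong : ∀ d {F G} → (∀ n → F n ≡ G n) → ∀ n → Δⁿ d F n ≡ Δⁿ d G n
Δⁿ-cong zero    eq = eq
Δⁿ-cong (suc d) eq = Δ-cong (Δⁿ-cong d eq)

Δⁿ-⊖ : ∀ d F G n → Δⁿ d (λ m → F m ⊖ G m) n ≡ Δⁿ d F n ⊖ Δⁿ d G n
Δⁿ-⊖ zero    F G n = refl
Δⁿ-⊖ (suc d) F G n = trans (Δ-cong (Δⁿ-⊖ d F G) n) (Δ-⊖ (Δⁿ d F) (Δⁿ d G) n)

Δⁿ-Δ : ∀ d F n → Δⁿ d (Δ F) n ≡ Δ (Δⁿ d F) n
Δⁿ-Δ zero    F n = refl
Δⁿ-Δ (suc d) F n = Δ-cong (Δⁿ-Δ d F) n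

Δⁿ-zero : ∀ d {F} → (∀ n → F n ≡ pos 0) → ∀ n → Δⁿ d F n ≡ pos 0
Δⁿ-zero zero    F≡0 n       = F≡0 n
Δⁿ-zero (suc d) F≡0 zero    = Δⁿ-zero d F≡0 zero
Δⁿ-zero (suc d) F≡0 (suc n) = cong₂ _⊖_ (Δⁿ-zero d F≡0 (suc n)) (Δⁿ-zero d F≡0 n)

module _ {X : Set} where

  -- Backward difference in a new leading variable, composed with D in the others.
  Δ⟨_⟩ : ((X → ℤ) → X → ℤ) → (ℕ × X → ℤ) → ℕ × X → ℤ
  Δ⟨ D ⟩ F (c , x) = Δ (λ c′ → D (λ y → F (c′ , y)) x) c

  Congruent : ((X → ℤ) → X → ℤ) → Set
  Congruent D = ∀ {F G} → (∀ x → F x ≡ G x) → ∀ x → D F x ≡ D G x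

  Additive : ((X → ℤ) → X → ℤ) → Set
  Additive D = ∀ F G x → D (λ y → F y ⊕ G y) x ≡ D F x ⊕ D G x

  Solves : ((X → ℤ) → X → ℤ) → (X → ℤ) → (X → ℤ) → Set
  Solves D g F = ∀ x → pos 2 ⊛ D F x ≡ F x ⊕ g x

  UniqueSolutions : ((X → ℤ) → X → ℤ) → Set
  UniqueSolutions D = ∀ g {F G} → Solves D g F → Solves D g G → ∀ x → F x ≡ G x

  id-uniqueSolutions : UniqueSolutions (λ F → F)
  id-uniqueSolutions g {F} {G} hF hG x = trans (halve (F x) (hF x)) (sym (halve (G x) (hG x)))
    where halve : ∀ u {v} → pos 2 ⊛ u ≡ u ⊕ v → u ≡ v
          halve u {v} eq = begin
            u                   ≡⟨ double-minus u ⟩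
            pos 2 ⊛ u ⊖ u       ≡⟨ cong (_⊖ u) eq ⟩
            u ⊕ v ⊖ u           ≡⟨ cancel u v ⟩
            v                   ∎
            where open ≡-Reasoning
                  double-minus : ∀ u → u ≡ pos 2 ⊛ u ⊖ u
                  double-minus = solve-∀
                  cancel : ∀ u v → u ⊕ v ⊖ u ≡ v
                  cancel = solve-∀

module _ {X : Set} {D : (X → ℤ) → X → ℤ} where

  Δ⟨⟩-cong : Congruent D → Congruent Δ⟨ D ⟩
  Δ⟨⟩-cong D-cong eq (c , x) = Δ-cong (λ c′ → D-cong (λ y → eq (c′ , y)) x) c

  Δ⟨⟩-⊕ : Congruent D → Additive D → Additive Δ⟨ D ⟩
  Δ⟨⟩-⊕ D-cong D-⊕ F G (c , x) =
    trans (Δ-cong (λ c′ → D-⊕ (λ y → F (c′ , y)) (λ y → G (c′ , y)) x) c)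
          (Δ-⊕ (λ c′ → D (λ y → F (c′ , y)) x) (λ c′ → D (λ y → G (c′ , y)) x) c)

  Δ⟨⟩-uniqueSolutions : Congruent D → UniqueSolutions D → UniqueSolutions Δ⟨ D ⟩
  Δ⟨⟩-uniqueSolutions D-cong D-unique g {F} {G} hF hG (c , x) = agree c x
    where
    slice : (ℕ × X → ℤ) → ℕ → X → ℤ
    slice H c y = H (c , y)
    absorb : ∀ {u v} w h → pos 2 ⊛ (u ⊖ v) ≡ w ⊕ h → pos 2 ⊛ u ≡ w ⊕ (h ⊕ pos 2 ⊛ v)
    absorb {u} {v} w h eq = begin
      pos 2 ⊛ u                         ≡⟨ split u v ⟩
      pos 2 ⊛ (u ⊖ v) ⊕ pos 2 ⊛ v       ≡⟨ cong (_⊕ pos 2 ⊛ v) eq ⟩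
      w ⊕ h ⊕ pos 2 ⊛ v                 ≡⟨ ℤP.+-assoc w h (pos 2 ⊛ v) ⟩
      w ⊕ (h ⊕ pos 2 ⊛ v)               ∎
      where open ≡-Reasoning
            split : ∀ u v → pos 2 ⊛ u ≡ pos 2 ⊛ (u ⊖ v) ⊕ pos 2 ⊛ v
            split = solve-∀
    -- Once F and G agree at c, the equation at c + 1 is an equation for D alone,
    -- with the known term 2 D (F c) moved into the right-hand side.
    agree : ∀ c y → F (c , y) ≡ G (c , y)
    agree zero = D-unique (slice g 0) (λ y → hF (0 , y)) (λ y → hG (0 , y))
    agree (suc c) = D-unique g′
      (λ y → absorb (F (suc c , y)) (g (suc c , y)) (hF (suc c , y)))
      (λ y → trans (absorb (G (suc c , y)) (g (suc c , y)) (hG (suc c , y)))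
                   (cong (λ z → G (suc c , y) ⊕ (g (suc c , y) ⊕ pos 2 ⊛ z))
                         (D-cong (λ y′ → sym (agree c y′)) y)))
      where g′ : X → ℤ
            g′ y = g (suc c , y) ⊕ pos 2 ⊛ D (slice F c) y

Δ-uniqueSolutions : UniqueSolutions Δ
Δ-uniqueSolutions g {F} {G} hF hG n =
  Δ⟨⟩-uniqueSolutions {X = ⊤} (λ eq → eq) id-uniqueSolutions
    (λ (m , _) → g m) {λ (m , _) → F m} {λ (m , _) → G m} (λ (m , _) → hF m) (λ (m , _) → hG m) (n , tt)

Δ₂ : (ℕ → ℕ → ℤ) → ℕ → ℕ → ℤ
Δ₂ F c d = Δ⟨ Δ ⟩ (uncurry F) (c , d)

Δ₃ : (ℕ → ℕ → ℕ → ℤ) → ℕ → ℕ → ℕ → ℤ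
Δ₃ F c d e = Δ⟨ Δ⟨ Δ ⟩ ⟩ (λ (c , d , e) → F c d e) (c , d , e)

Δ₂-cong : ∀ {F G} → (∀ c d → F c d ≡ G c d) → ∀ c d → Δ₂ F c d ≡ Δ₂ G c d
Δ₂-cong eq c d = Δ⟨⟩-cong Δ-cong (uncurry eq) (c , d)

Δ₃-cong : ∀ {F G} → (∀ c d e → F c d e ≡ G c d e) → ∀ c d e → Δ₃ F c d e ≡ Δ₃ G c d e
Δ₃-cong eq c d e = Δ⟨⟩-cong (Δ⟨⟩-cong Δ-cong) (λ (c , d , e) → eq c d e) (c , d , e)

Δ₃-⊕ : ∀ F G c d e → Δ₃ (λ c d e → F c d e ⊕ G c d e) c d e ≡ Δ₃ F c d e ⊕ Δ₃ G c d e
Δ₃-⊕ F G c d e =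
  Δ⟨⟩-⊕ (Δ⟨⟩-cong Δ-cong) (Δ⟨⟩-⊕ Δ-cong Δ-⊕)
        (λ (c , d , e) → F c d e) (λ (c , d , e) → G c d e) (c , d , e)

Δ₂-uniqueSolutions : ∀ (g : ℕ → ℕ → ℤ) {F G} →
                     (∀ c d → pos 2 ⊛ Δ₂ F c d ≡ F c d ⊕ g c d) →
                     (∀ c d → pos 2 ⊛ Δ₂ G c d ≡ G c d ⊕ g c d) →
                     ∀ c d → F c d ≡ G c d
Δ₂-uniqueSolutions g hF hG c d =
  Δ⟨⟩-uniqueSolutions Δ-cong Δ-uniqueSolutions (uncurry g) (uncurry hF) (uncurry hG) (c , d)

Δ₃-uniqueSolutions : ∀ (g : ℕ → ℕ → ℕ → ℤ) {F G} →
                     (∀ c d e → pos 2 ⊛ Δ₃ F c d e ≡ F c d e ⊕ g c d e) →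
                     (∀ c d e → pos 2 ⊛ Δ₃ G c d e ≡ G c d e ⊕ g c d e) →
                     ∀ c d e → F c d e ≡ G c d e
Δ₃-uniqueSolutions g {F} {G} hF hG c d e =
  Δ⟨⟩-uniqueSolutions (Δ⟨⟩-cong Δ-cong) (Δ⟨⟩-uniqueSolutions Δ-cong Δ-uniqueSolutions)
    (λ (c , d , e) → g c d e) {λ (c , d , e) → F c d e} {λ (c , d , e) → G c d e}
    (λ (c , d , e) → hF c d e) (λ (c , d , e) → hG c d e) (c , d , e)

δ₁ : ℕ → ℤ
δ₁ zero    = pos 1
δ₁ (suc _) = pos 0

δ₂ : ℕ → ℕ → ℤ
δ₂ c zero    = δ₁ c
δ₂ c (suc d) = pos 0

δ₃ : ℕ → ℕ → ℕ → ℤ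
δ₃ c d zero    = δ₂ c d
δ₃ c d (suc e) = pos 0

box : (ℕ → ℕ → ℕ → ℤ) → ℕ → ℕ → ℕ → ℤ
box F c d e = Σℤ c (λ i → Σℤ d (λ j → Σℤ e (λ k → F i j k)))

Δ₃-box : ∀ F c d e → Δ₃ (box F) c d e ≡ F c d e
Δ₃-box F c d e = trans (Δ-cong (λ c′ → trans (Δ-cong (λ d′ → Δ-in-e c′ d′) d) (Δ-in-d c′)) c)
                       (Δ-Σℤ-prefix (λ i → F i d e) c)
  where
  Δ-in-e : ∀ c′ d′ → Δ (box F c′ d′) e ≡ Σℤ c′ (λ i → Σℤ d′ (λ j → F i j e))
  Δ-in-e c′ d′ = trans (Δ-Σℤ c′ (λ i m → Σℤ d′ (λ j → Σℤ m (F i j))) e)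
                       (Σℤ-cong c′ (λ i → trans (Δ-Σℤ d′ (λ j m → Σℤ m (F i j)) e)
                                               (Σℤ-cong d′ (λ j → Δ-Σℤ-prefix (F i j) e))))
  Δ-in-d : ∀ c′ → Δ (λ d′ → Σℤ c′ (λ i → Σℤ d′ (λ j → F i j e))) d ≡ Σℤ c′ (λ i → F i d e)
  Δ-in-d c′ = trans (Δ-Σℤ c′ (λ i m → Σℤ m (λ j → F i j e)) d)
                    (Σℤ-cong c′ (λ i → Δ-Σℤ-prefix (λ j → F i j e) d))

Δ₃-one : ∀ c d e → Δ₃ (λ _ _ _ → pos 1) c d e ≡ δ₃ c d e
Δ₃-one zero    zero    zero    = refl
Δ₃-one zero    zero    (suc e) = refl
Δ₃-one zero    (suc d) zero    = refl
Δ₃-one zero    (suc d) (suc e) = refl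
Δ₃-one (suc c) zero    zero    = refl
Δ₃-one (suc c) zero    (suc e) = refl
Δ₃-one (suc c) (suc d) zero    = refl
Δ₃-one (suc c) (suc d) (suc e) = refl

box-solves : ∀ A → (∀ c d e → A c d e ⊕ A c d e ≡ pos 1 ⊕ box A c d e) →
             ∀ c d e → pos 2 ⊛ Δ₃ A c d e ≡ A c d e ⊕ δ₃ c d e
box-solves A h c d e = begin
  pos 2 ⊛ Δ₃ A c d e                                      ≡⟨ double (Δ₃ A c d e) ⟩
  Δ₃ A c d e ⊕ Δ₃ A c d e                                 ≡⟨ Δ₃-⊕ A A c d e ⟨
  Δ₃ (λ c d e → A c d e ⊕ A c d e) c d e                  ≡⟨ Δ₃-cong h c d e ⟩
  Δ₃ (λ c d e → pos 1 ⊕ box A c d e) c d e                ≡⟨ Δ₃-⊕ (λ _ _ _ → pos 1) (box A) c d e ⟩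
  Δ₃ (λ _ _ _ → pos 1) c d e ⊕ Δ₃ (box A) c d e           ≡⟨ cong₂ _⊕_ (Δ₃-one c d e) (Δ₃-box A c d e) ⟩
  δ₃ c d e ⊕ A c d e                                      ≡⟨ ℤP.+-comm (δ₃ c d e) (A c d e) ⟩
  A c d e ⊕ δ₃ c d e                                      ∎
  where open ≡-Reasoning
        double : ∀ x → pos 2 ⊛ x ≡ x ⊕ x
        double = solve-∀

pos-sumTo³ : ∀ c d e (f : ℕ → ℕ → ℕ → ℕ) →
             pos (sumTo c (λ i → sumTo d (λ j → sumTo e (f i j)))) ≡ box (λ i j k → pos (f i j k)) c d e
pos-sumTo³ c d e f =
  trans (pos-sumTo c _) (Σℤ-cong c (λ i → trans (pos-sumTo d _) (Σℤ-cong d (λ j → pos-sumTo e (f i j)))))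

-- The transform T

-- lag F c j = F (c ∸ j), except that it is 0 (not F 0) for j > c.
lag : (ℕ → ℤ) → ℕ → ℕ → ℤ
lag F c       zero    = F c
lag F zero    (suc j) = pos 0
lag F (suc c) (suc j) = lag F c j

lag-≤ : ∀ F c j → j ≤ c → lag F c j ≡ F (c ∸ j)
lag-≤ F c       zero    _         = refl
lag-≤ F (suc c) (suc j) (s≤s j≤c) = lag-≤ F c j j≤c

lag-> : ∀ F c j → c < j → lag F c j ≡ pos 0
lag-> F zero    (suc j) _         = refl
lag-> F (suc c) (suc j) (s≤s c<j) = lag-> F c j c<j

Δⁿ-binomial : ∀ d F c → Δⁿ d F c ≡ Σℤ d (λ j → pos (d C j) ⊛ (sign j ⊛ lag F c j))
Δⁿ-binomial zero F c = sym (unit (F c))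
  where unit : ∀ x → pos 1 ⊛ (pos 1 ⊛ x) ≡ x
        unit = solve-∀
Δⁿ-binomial (suc d) F zero = begin
  Δⁿ d F 0
    ≡⟨ Δⁿ-binomial d F 0 ⟩
  S
    ≡⟨ sym (ℤP.+-identityʳ S) ⟩
  S ⊕ pos 0
    ≡⟨ cong (S ⊕_) (sym (trans (Σℤ-cong d (λ j → vanish (pos (d C j)) (sign j))) (Σℤ-zero d))) ⟩
  S ⊕ Σℤ d (λ j → pos (d C j) ⊛ (sign (suc j) ⊛ lag F 0 (suc j)))
    ≡⟨ sym (Σℤ-pascal d (λ j → sign j ⊛ lag F 0 j)) ⟩
  Σℤ (suc d) (λ j → pos (suc d C j) ⊛ (sign j ⊛ lag F 0 j)) ∎
  where open ≡-Reasoning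
        S = Σℤ d (λ j → pos (d C j) ⊛ (sign j ⊛ lag F 0 j))
        vanish : ∀ a s → a ⊛ (⊝ s ⊛ pos 0) ≡ pos 0
        vanish = solve-∀
Δⁿ-binomial (suc d) F (suc c) = begin
  Δⁿ d F (suc c) ⊖ Δⁿ d F c
    ≡⟨ cong₂ _⊖_ (Δⁿ-binomial d F (suc c)) (Δⁿ-binomial d F c) ⟩
  S ⊖ Σℤ d (λ j → pos (d C j) ⊛ (sign j ⊛ lag F c j))
    ≡⟨ cong (S ⊕_) (sym (Σℤ-neg d _)) ⟩
  S ⊕ Σℤ d (λ j → ⊝ (pos (d C j) ⊛ (sign j ⊛ lag F c j)))
    ≡⟨ cong (S ⊕_) (Σℤ-cong d (λ j → flip (pos (d C j)) (sign j) (lag F c j))) ⟩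
  S ⊕ Σℤ d (λ j → pos (d C j) ⊛ (sign (suc j) ⊛ lag F (suc c) (suc j)))
    ≡⟨ sym (Σℤ-pascal d (λ j → sign j ⊛ lag F (suc c) j)) ⟩
  Σℤ (suc d) (λ j → pos (suc d C j) ⊛ (sign j ⊛ lag F (suc c) j)) ∎
  where open ≡-Reasoning
        S = Σℤ d (λ j → pos (d C j) ⊛ (sign j ⊛ lag F (suc c) j))
        flip : ∀ a s x → ⊝ (a ⊛ (s ⊛ x)) ≡ a ⊛ (⊝ s ⊛ x)
        flip = solve-∀

shiftC : ℕ → (ℕ → ℤ) → ℕ → ℤ
shiftC d G n = pos ((n + d) C d) ⊛ G (n + d)

shiftC-zero : ∀ G n → shiftC 0 G n ≡ G n
shiftC-zero G n rewrite ℕP.+-identityʳ n = ℤP.*-identityˡ (G n)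

-- A discrete product rule; the binomial coefficients combine by Pascal's rule.
Δ-shiftC : ∀ d G n → Δ (shiftC (suc d) G) n ≡ shiftC d G n ⊕ shiftC (suc d) (Δ G) n
Δ-shiftC d G zero rewrite nCn≡1 d | nCn≡1 (suc d) = leibniz (G (suc d)) (G d)
  where leibniz : ∀ x y → pos 1 ⊛ x ≡ pos 1 ⊛ y ⊕ pos 1 ⊛ (x ⊖ y)
        leibniz = solve-∀
Δ-shiftC d G (suc m) rewrite ℕP.+-suc m d =
  leibniz (pos (suc (m + d) C d)) (pos (suc (m + d) C suc d)) (G (suc (suc (m + d)))) (G (suc (m + d)))
          (pascal (suc (m + d)) d)
  where
  leibniz : ∀ c₁ c₂ {c₃} x y → c₃ ≡ c₁ ⊕ c₂ → c₃ ⊛ x ⊖ c₂ ⊛ y ≡ c₁ ⊛ y ⊕ c₃ ⊛ (x ⊖ y)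
  leibniz c₁ c₂ x y refl = ring c₁ c₂ x y
    where ring : ∀ c₁ c₂ x y → (c₁ ⊕ c₂) ⊛ x ⊖ c₂ ⊛ y ≡ c₁ ⊛ y ⊕ (c₁ ⊕ c₂) ⊛ (x ⊖ y)
          ring = solve-∀

-- The right-hand side of the three-prime formula, with G m standing for a(p ^ m * r ^ e).
T-coefficient : ℕ → ℕ → ℕ → ℤ
T-coefficient c d j = sign j ⊛ pos ((d C j) * ((c + d ∸ j) C d))

T : (ℕ → ℤ) → ℕ → ℕ → ℤ
T G c d = Σℤ d (λ j → T-coefficient c d j ⊛ G (c + d ∸ j))

C*C≡0 : ∀ c d j → c < j → (d C j) * ((c + d ∸ j) C d) ≡ 0
C*C≡0 c d j c<j with ℕP.≤-<-connex j d
... | inj₁ j≤d = trans (cong ((d C j) *_) (k>n⇒nCk≡0 c+d∸j<d)) (ℕP.*-zeroʳ (d C j))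
  where c+d∸j<d : c + d ∸ j < d
        c+d∸j<d = subst₂ _<_ (sym (ℕP.+-∸-assoc c j≤d)) (ℕP.m+[n∸m]≡n j≤d) (ℕP.+-monoˡ-< (d ∸ j) c<j)
... | inj₂ d<j = cong (_* ((c + d ∸ j) C d)) (k>n⇒nCk≡0 d<j)

T≡Δⁿ-shiftC : ∀ G c d → T G c d ≡ Δⁿ d (shiftC d G) c
T≡Δⁿ-shiftC G c d = sym (trans (Δⁿ-binomial d (shiftC d G) c) (Σℤ-cong d term))
  where
  reassoc : ∀ a b s x → a ⊛ (s ⊛ (b ⊛ x)) ≡ (s ⊛ (a ⊛ b)) ⊛ x
  reassoc = solve-∀
  vanish : ∀ a s x → a ⊛ (s ⊛ pos 0) ≡ (s ⊛ pos 0) ⊛ x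
  vanish = solve-∀
  term : ∀ j → pos (d C j) ⊛ (sign j ⊛ lag (shiftC d G) c j) ≡ T-coefficient c d j ⊛ G (c + d ∸ j)
  term j with ℕP.≤-<-connex j c
  ... | inj₁ j≤c rewrite lag-≤ (shiftC d G) c j j≤c | ℕP.+-∸-comm {c} d j≤c =
    trans (reassoc (pos (d C j)) (pos ((c ∸ j + d) C d)) (sign j) (G (c ∸ j + d)))
          (cong (λ z → (sign j ⊛ z) ⊛ G (c ∸ j + d)) (sym (ℤP.pos-* (d C j) ((c ∸ j + d) C d))))
  ... | inj₂ c<j rewrite lag-> (shiftC d G) c j c<j | C*C≡0 c d j c<j =
    vanish (pos (d C j)) (sign j) (G (c + d ∸ j))

T-cong : ∀ {F G} → (∀ m → F m ≡ G m) → ∀ c d → T F c d ≡ T G c d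
T-cong eq c d = Σℤ-cong d (λ j → cong (T-coefficient c d j ⊛_) (eq (c + d ∸ j)))

T-⊕ : ∀ F G c d → T (λ m → F m ⊕ G m) c d ≡ T F c d ⊕ T G c d
T-⊕ F G c d = trans (Σℤ-cong d (λ j → ℤP.*-distribˡ-+ (T-coefficient c d j) _ _)) (Σℤ-distrib-⊕ d _ _)

T-⊖ : ∀ F G c d → T (λ m → F m ⊖ G m) c d ≡ T F c d ⊖ T G c d
T-⊖ F G c d = trans (Σℤ-cong d (λ j → distrib (T-coefficient c d j) _ _))
                    (trans (Σℤ-distrib-⊕ d _ _) (cong (T F c d ⊕_) (Σℤ-neg d _)))
  where distrib : ∀ w x y → w ⊛ (x ⊖ y) ≡ w ⊛ x ⊕ ⊝ (w ⊛ y)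
        distrib = solve-∀

T-*ˡ : ∀ k F c d → T (λ m → k ⊛ F m) c d ≡ k ⊛ T F c d
T-*ˡ k F c d = trans (Σℤ-cong d (λ j → commute (T-coefficient c d j) k _)) (Σℤ-*ˡ d k _)
  where commute : ∀ w k x → w ⊛ (k ⊛ x) ≡ k ⊛ (w ⊛ x)
        commute = solve-∀

T-zero : ∀ c d → T (λ _ → pos 0) c d ≡ pos 0
T-zero c d = trans (Σℤ-cong d (λ j → ℤP.*-zeroʳ (T-coefficient c d j))) (Σℤ-zero d)

T-δ₁ : ∀ c d → T δ₁ c d ≡ δ₂ c d
T-δ₁ c zero    = trans (T≡Δⁿ-shiftC δ₁ c 0) (shiftC-zero δ₁ c)
T-δ₁ c (suc d) = trans (T≡Δⁿ-shiftC δ₁ c (suc d)) (Δⁿ-zero (suc d) shiftC-δ₁ c)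
  where shiftC-δ₁ : ∀ n → shiftC (suc d) δ₁ n ≡ pos 0
        shiftC-δ₁ n rewrite ℕP.+-suc n d = ℤP.*-zeroʳ (pos (suc (n + d) C suc d))

Δ₂-T : ∀ G c d → Δ₂ (T G) c d ≡ T (Δ G) c d
Δ₂-T G c zero = begin
  Δ (λ c′ → T G c′ 0) c   ≡⟨ Δ-cong (λ c′ → trans (T≡Δⁿ-shiftC G c′ 0) (shiftC-zero G c′)) c ⟩
  Δ G c                   ≡⟨ sym (trans (T≡Δⁿ-shiftC (Δ G) c 0) (shiftC-zero (Δ G) c)) ⟩
  T (Δ G) c 0             ∎
  where open ≡-Reasoning
Δ₂-T G c (suc d) = begin
  Δ (λ c′ → T G c′ (suc d) ⊖ T G c′ d) c
    ≡⟨ Δ-cong (λ c′ → cong₂ _⊖_ (T≡Δⁿ-shiftC G c′ (suc d)) (T≡Δⁿ-shiftC G c′ d)) c ⟩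
  Δ (λ c′ → Δⁿ (suc d) (shiftC (suc d) G) c′ ⊖ Δⁿ d (shiftC d G) c′) c
    ≡⟨ Δ-⊖ _ _ c ⟩
  Δ (Δⁿ (suc d) (shiftC (suc d) G)) c ⊖ Δⁿ (suc d) (shiftC d G) c
    ≡⟨ cong (_⊖ Δⁿ (suc d) (shiftC d G) c) (sym (Δⁿ-Δ (suc d) (shiftC (suc d) G) c)) ⟩
  Δⁿ (suc d) (Δ (shiftC (suc d) G)) c ⊖ Δⁿ (suc d) (shiftC d G) c
    ≡⟨ sym (Δⁿ-⊖ (suc d) _ _ c) ⟩
  Δⁿ (suc d) (λ n → Δ (shiftC (suc d) G) n ⊖ shiftC d G n) c
    ≡⟨ Δⁿ-cong (suc d) (λ n → trans (cong (_⊖ shiftC d G n) (Δ-shiftC d G n)) (cancel (shiftC d G n) _)) c ⟩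
  Δⁿ (suc d) (shiftC (suc d) (Δ G)) c
    ≡⟨ sym (T≡Δⁿ-shiftC (Δ G) c (suc d)) ⟩
  T (Δ G) c (suc d) ∎
  where open ≡-Reasoning
        cancel : ∀ x y → x ⊕ y ⊖ x ≡ y
        cancel = solve-∀

T-Δ-parameter : ∀ (G : ℕ → ℕ → ℤ) c d e →
                Δ (λ e′ → T (λ m → G m e′) c d) e ≡ T (λ m → Δ (G m) e) c d
T-Δ-parameter G c d zero    = refl
T-Δ-parameter G c d (suc e) = sym (T-⊖ (λ m → G m (suc e)) (λ m → G m e) c d)

T-solves : ∀ (G : ℕ → ℕ → ℤ) → (∀ m e → pos 2 ⊛ Δ₂ G m e ≡ G m e ⊕ δ₂ m e) →
           ∀ c d e → pos 2 ⊛ Δ₃ (λ c d e → T (λ m → G m e) c d) c d e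
                     ≡ T (λ m → G m e) c d ⊕ δ₃ c d e
T-solves G hG c d e = begin
  pos 2 ⊛ Δ₃ X c d e
    ≡⟨ cong (pos 2 ⊛_) (Δ₂-cong (λ c′ d′ → T-Δ-parameter G c′ d′ e) c d) ⟩
  pos 2 ⊛ Δ₂ (T (λ m → Δ (G m) e)) c d
    ≡⟨ cong (pos 2 ⊛_) (Δ₂-T (λ m → Δ (G m) e) c d) ⟩
  pos 2 ⊛ T (λ m → Δ₂ G m e) c d
    ≡⟨ sym (T-*ˡ (pos 2) (λ m → Δ₂ G m e) c d) ⟩
  T (λ m → pos 2 ⊛ Δ₂ G m e) c d
    ≡⟨ T-cong (λ m → hG m e) c d ⟩
  T (λ m → G m e ⊕ δ₂ m e) c d
    ≡⟨ T-⊕ (λ m → G m e) (λ m → δ₂ m e) c d ⟩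
  X c d e ⊕ T (λ m → δ₂ m e) c d
    ≡⟨ cong (X c d e ⊕_) (T-δ₂ e) ⟩
  X c d e ⊕ δ₃ c d e ∎
  where
  open ≡-Reasoning
  X : ℕ → ℕ → ℕ → ℤ
  X c d e = T (λ m → G m e) c d
  T-δ₂ : ∀ e → T (λ m → δ₂ m e) c d ≡ δ₃ c d e
  T-δ₂ zero    = T-δ₁ c d
  T-δ₂ (suc e) = T-zero c d

-- The two-prime count

binomialSum : ℕ → ℕ → ℤ
binomialSum c d = Σℤ d (λ i → pos (d C i) ⊛ pos ((c + i) C i))

binomialSum-0-suc : ∀ d → binomialSum 0 (suc d) ≡ pos 2 ⊛ binomialSum 0 d
binomialSum-0-suc d = begin
  binomialSum 0 (suc d)
    ≡⟨ Σℤ-pascal d (λ i → pos (i C i)) ⟩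
  binomialSum 0 d ⊕ Σℤ d (λ i → pos (d C i) ⊛ pos (suc i C suc i))
    ≡⟨ cong (binomialSum 0 d ⊕_) (Σℤ-cong d (λ i → cong (λ z → pos (d C i) ⊛ pos z) (diagonal i))) ⟩
  binomialSum 0 d ⊕ binomialSum 0 d
    ≡⟨ double (binomialSum 0 d) ⟩
  pos 2 ⊛ binomialSum 0 d ∎
  where open ≡-Reasoning
        diagonal : ∀ i → suc i C suc i ≡ i C i
        diagonal i = trans (nCn≡1 (suc i)) (sym (nCn≡1 i))
        double : ∀ x → x ⊕ x ≡ pos 2 ⊛ x
        double = solve-∀

binomialSum-pascal : ∀ c d → binomialSum (suc c) (suc d) ⊕ binomialSum c d
                             ≡ binomialSum c (suc d) ⊕ pos 2 ⊛ binomialSum (suc c) d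
binomialSum-pascal c d = begin
  binomialSum (suc c) (suc d) ⊕ binomialSum c d
    ≡⟨ cong (_⊕ binomialSum c d) (Σℤ-pascal d (λ i → pos ((suc c + i) C i))) ⟩
  (binomialSum (suc c) d ⊕ Σℤ d (λ i → pos (d C i) ⊛ pos (suc (c + suc i) C suc i))) ⊕ binomialSum c d
    ≡⟨ cong (λ z → (binomialSum (suc c) d ⊕ z) ⊕ binomialSum c d) (Σℤ-cong d split) ⟩
  (binomialSum (suc c) d ⊕ Σℤ d (λ i → pos (d C i) ⊛ pos ((suc c + i) C i) ⊕ R i)) ⊕ binomialSum c d
    ≡⟨ cong (λ z → (binomialSum (suc c) d ⊕ z) ⊕ binomialSum c d) (Σℤ-distrib-⊕ d _ R) ⟩
  (binomialSum (suc c) d ⊕ (binomialSum (suc c) d ⊕ Σℤ d R)) ⊕ binomialSum c d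
    ≡⟨ regroup (binomialSum (suc c) d) (Σℤ d R) (binomialSum c d) ⟩
  (binomialSum c d ⊕ Σℤ d R) ⊕ pos 2 ⊛ binomialSum (suc c) d
    ≡⟨ cong (_⊕ pos 2 ⊛ binomialSum (suc c) d) (sym (Σℤ-pascal d (λ i → pos ((c + i) C i)))) ⟩
  binomialSum c (suc d) ⊕ pos 2 ⊛ binomialSum (suc c) d ∎
  where
  open ≡-Reasoning
  R : ℕ → ℤ
  R i = pos (d C i) ⊛ pos ((c + suc i) C suc i)
  regroup : ∀ f s g → (f ⊕ (f ⊕ s)) ⊕ g ≡ (g ⊕ s) ⊕ pos 2 ⊛ f
  regroup = solve-∀
  split : ∀ i → pos (d C i) ⊛ pos (suc (c + suc i) C suc i) ≡ pos (d C i) ⊛ pos ((suc c + i) C i) ⊕ R i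
  split i = trans (cong (pos (d C i) ⊛_) (pascal (c + suc i) i))
                  (trans (ℤP.*-distribˡ-+ (pos (d C i)) _ _)
                         (cong (λ z → pos (d C i) ⊛ pos (z C i) ⊕ R i) (ℕP.+-suc c i)))

binomialSum-suc-suc : ∀ c d → binomialSum (suc c) (suc d)
                              ≡ binomialSum c (suc d) ⊕ pos 2 ⊛ binomialSum (suc c) d ⊖ binomialSum c d
binomialSum-suc-suc c d =
  trans (add-sub (binomialSum (suc c) (suc d)) (binomialSum c d)) (cong (_⊖ binomialSum c d) (binomialSum-pascal c d))
  where add-sub : ∀ x y → x ≡ x ⊕ y ⊖ y
        add-sub = solve-∀

twoPrimeCount : ℕ → ℕ → ℤ
twoPrimeCount c d = pos (2 ^ c) ⊛ binomialSum c d

twoPrimeCount-solves : ∀ c d → pos 2 ⊛ Δ₂ twoPrimeCount c d ≡ twoPrimeCount c d ⊕ δ₂ c d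
twoPrimeCount-solves zero    zero    = refl
twoPrimeCount-solves (suc c) zero    = edge {pos (2 ^ suc c)} {pos (2 ^ c)} (ℤP.pos-* 2 (2 ^ c))
  where edge : ∀ {Q P} → Q ≡ pos 2 ⊛ P → pos 2 ⊛ (Q ⊛ pos 1 ⊖ P ⊛ pos 1) ≡ Q ⊛ pos 1 ⊕ pos 0
        edge {P = P} refl = ring P
          where ring : ∀ P → pos 2 ⊛ ((pos 2 ⊛ P) ⊛ pos 1 ⊖ P ⊛ pos 1) ≡ (pos 2 ⊛ P) ⊛ pos 1 ⊕ pos 0
                ring = solve-∀
twoPrimeCount-solves zero    (suc d) = edge {binomialSum 0 (suc d)} {binomialSum 0 d} (binomialSum-0-suc d)
  where edge : ∀ {F f} → F ≡ pos 2 ⊛ f → pos 2 ⊛ (pos 1 ⊛ F ⊖ pos 1 ⊛ f) ≡ pos 1 ⊛ F ⊕ pos 0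
        edge {f = f} refl = ring f
          where ring : ∀ f → pos 2 ⊛ (pos 1 ⊛ (pos 2 ⊛ f) ⊖ pos 1 ⊛ f) ≡ pos 1 ⊛ (pos 2 ⊛ f) ⊕ pos 0
                ring = solve-∀
twoPrimeCount-solves (suc c) (suc d) =
  interior {pos (2 ^ suc c)} {pos (2 ^ c)} {binomialSum (suc c) (suc d)} {binomialSum (suc c) d}
           {binomialSum c (suc d)} {binomialSum c d} (ℤP.pos-* 2 (2 ^ c)) (binomialSum-suc-suc c d)
  where
  interior : ∀ {Q P f₁₁ f₁₀ f₀₁ f₀₀} → Q ≡ pos 2 ⊛ P → f₁₁ ≡ f₀₁ ⊕ pos 2 ⊛ f₁₀ ⊖ f₀₀ →
             pos 2 ⊛ ((Q ⊛ f₁₁ ⊖ Q ⊛ f₁₀) ⊖ (P ⊛ f₀₁ ⊖ P ⊛ f₀₀)) ≡ Q ⊛ f₁₁ ⊕ pos 0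
  interior {P = P} {f₁₀ = f₁₀} {f₀₁} {f₀₀} refl refl = ring P f₁₀ f₀₁ f₀₀
    where
    ring : ∀ P f₁₀ f₀₁ f₀₀ →
           let Q = pos 2 ⊛ P ; f₁₁ = f₀₁ ⊕ pos 2 ⊛ f₁₀ ⊖ f₀₀ in
           pos 2 ⊛ ((Q ⊛ f₁₁ ⊖ Q ⊛ f₁₀) ⊖ (P ⊛ f₀₁ ⊖ P ⊛ f₀₀)) ≡ Q ⊛ f₁₁ ⊕ pos 0
    ring = solve-∀

-- Divisor sums

Unique-map⁺ : ∀ {A B : Set} (f : A → B) {xs : List A} → Unique xs →
              (∀ {x y} → x ∈ xs → y ∈ xs → f x ≡ f y → x ≡ y) → Unique (map f xs)
Unique-map⁺ f {[]}     []         _      = []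
Unique-map⁺ f {x ∷ xs} (x∉ ∷ xs!) f-inj =
  AllP.map⁺ (All.tabulate (λ y∈ fx≡fy → All.lookup x∉ y∈ (f-inj (here refl) (there y∈) fx≡fy)))
  ∷ Unique-map⁺ f xs! (λ x∈ y∈ → f-inj (there x∈) (there y∈))

sum-cartesianProduct : ∀ {A B : Set} (g : A × B → ℕ) xs ys →
  sum (map g (cartesianProduct xs ys)) ≡ sum (map (λ x → sum (map (λ y → g (x , y)) ys)) xs)
sum-cartesianProduct g []       ys = refl
sum-cartesianProduct g (x ∷ xs) ys = begin
  sum (map g (map (x ,_) ys ++ cartesianProduct xs ys))
    ≡⟨ cong sum (LP.map-++ g (map (x ,_) ys) (cartesianProduct xs ys)) ⟩
  sum (map g (map (x ,_) ys) ++ map g (cartesianProduct xs ys))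
    ≡⟨ ℕLP.sum-++ (map g (map (x ,_) ys)) _ ⟩
  sum (map g (map (x ,_) ys)) + sum (map g (cartesianProduct xs ys))
    ≡⟨ cong₂ _+_ (cong sum (sym (LP.map-∘ ys))) (sum-cartesianProduct g xs ys) ⟩
  sum (map (λ y → g (x , y)) ys) + sum (map (λ x → sum (map (λ y → g (x , y)) ys)) xs) ∎
  where open ≡-Reasoning

properDivisors-≤ : ∀ n {m} → m ∈ properDivisors n → m ≤ n ∸ 1
properDivisors-≤ n m∈ with ∈-map⁻ suc (proj₁ (∈-filter⁻ (_∣? n) {xs = map suc (upTo (n ∸ 1))} m∈))
... | i , i∈ , refl = ∈-upTo⁻ i∈

aFuel-stable : ∀ f g n → n ≤ f → n ≤ g → aFuel f n ≡ aFuel g n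
aFuel-stable zero    zero    zero    _         _         = refl
aFuel-stable zero    (suc g) zero    _         _         = refl
aFuel-stable (suc f) zero    zero    _         _         = refl
aFuel-stable (suc f) (suc g) zero    _         _         = refl
aFuel-stable (suc f) (suc g) (suc n) (s≤s n≤f) (s≤s n≤g) =
  cong (λ s → if 1 <ᵇ suc n then 1 + s else 1) (cong sum (LP.map-cong-local (All.tabulate stable)))
  where stable : ∀ {m} → m ∈ properDivisors (suc n) → aFuel f m ≡ aFuel g m
        stable m∈ = aFuel-stable f g _ (ℕP.≤-trans (properDivisors-≤ (suc n) m∈) n≤f)
                                       (ℕP.≤-trans (properDivisors-≤ (suc n) m∈) n≤g)

a-suc : ∀ n → a (suc n) ≡ 1 + sum (map a (properDivisors (suc n)))
a-suc zero    = refl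
a-suc (suc n) = cong (1 +_) (cong sum (LP.map-cong-local (All.tabulate stable)))
  where stable : ∀ {m} → m ∈ properDivisors (suc (suc n)) → aFuel (suc n) m ≡ a m
        stable m∈ = aFuel-stable (suc n) _ _ (properDivisors-≤ (suc (suc n)) m∈) ℕP.≤-refl

divisors : ℕ → List ℕ
divisors N = filter (_∣? N) (map suc (upTo N))

divisors-suc : ∀ n → divisors (suc n) ≡ properDivisors (suc n) ++ [ suc n ]
divisors-suc n = begin
  filter (_∣? suc n) (map suc (upTo (suc n)))
    ≡⟨ cong (filter (_∣? suc n) ∘ map suc) (sym (LP.upTo-∷ʳ n)) ⟩
  filter (_∣? suc n) (map suc (upTo n ++ [ n ]))
    ≡⟨ cong (filter (_∣? suc n)) (LP.map-++ suc (upTo n) [ n ]) ⟩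
  filter (_∣? suc n) (map suc (upTo n) ++ [ suc n ])
    ≡⟨ LP.filter-++ (_∣? suc n) (map suc (upTo n)) [ suc n ] ⟩
  properDivisors (suc n) ++ filter (_∣? suc n) [ suc n ]
    ≡⟨ cong (properDivisors (suc n) ++_) (LP.filter-accept (_∣? suc n) ∣-refl) ⟩
  properDivisors (suc n) ++ [ suc n ] ∎
  where open ≡-Reasoning

∈-divisors⁻ : ∀ {m N} → m ∈ divisors N → m ∣ N
∈-divisors⁻ {m} {N} m∈ = proj₂ (∈-filter⁻ (_∣? N) {xs = map suc (upTo N)} m∈)

∈-divisors⁺ : ∀ {m N} → .{{NonZero N}} → m ∣ N → m ∈ divisors N
∈-divisors⁺ {zero}  {N} 0∣N = ⊥-elim (ℕ.≢-nonZero⁻¹ N (0∣⇒≡0 0∣N))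
∈-divisors⁺ {suc m} {N} m∣N = ∈-filter⁺ (_∣? N) (∈-map⁺ suc (∈-upTo⁺ (∣⇒≤ m∣N))) m∣N

divisors-unique : ∀ N → Unique (divisors N)
divisors-unique N = UniqueP.filter⁺ (_∣? N) (UniqueP.map⁺ ℕP.suc-injective (UniqueP.upTo⁺ N))

divisorSum : (ℕ → ℕ) → ℕ → ℕ
divisorSum g N = sum (map g (divisors N))

a+a≡1+divisorSum : ∀ N → .{{NonZero N}} → a N + a N ≡ 1 + divisorSum a N
a+a≡1+divisorSum (suc n) = begin
  a (suc n) + a (suc n)                         ≡⟨ cong (_+ a (suc n)) (a-suc n) ⟩
  1 + S + a (suc n)                             ≡⟨ ℕP.+-assoc 1 S (a (suc n)) ⟩
  1 + (S + a (suc n))                           ≡⟨ cong (1 +_) sum-snoc ⟩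
  1 + sum (map a (properDivisors (suc n) ++ [ suc n ]))
                                                ≡⟨ cong (λ ds → 1 + sum (map a ds)) (divisors-suc n) ⟨
  1 + divisorSum a (suc n)                      ∎
  where
  open ≡-Reasoning
  S = sum (map a (properDivisors (suc n)))
  sum-snoc : S + a (suc n) ≡ sum (map a (properDivisors (suc n) ++ [ suc n ]))
  sum-snoc = begin
    S + a (suc n)                                        ≡⟨ cong (S +_) (ℕP.+-identityʳ (a (suc n))) ⟨
    S + sum [ a (suc n) ]                                ≡⟨ ℕLP.sum-++ (map a (properDivisors (suc n))) [ a (suc n) ] ⟨
    sum (map a (properDivisors (suc n)) ++ [ a (suc n) ]) ≡⟨ cong sum (LP.map-++ a (properDivisors (suc n)) [ suc n ]) ⟨
    sum (map a (properDivisors (suc n) ++ [ suc n ]))    ∎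

prime≢1 : ∀ {p} → Prime p → p ≢ 1
prime≢1 pp = ℕ.nonTrivial⇒≢1 {{prime⇒nonTrivial pp}}

prime^-nonZero : ∀ {p} → Prime p → ∀ k → NonZero (p ^ k)
prime^-nonZero {p} pp k = ℕP.m^n≢0 p k {{prime⇒nonZero pp}}

prime∣prime⇒≡ : ∀ {p q} → Prime p → Prime q → p ∣ q → p ≡ q
prime∣prime⇒≡ pp pq p∣q with prime⇒irreducible pq p∣q
... | inj₁ p≡1 = ⊥-elim (prime≢1 pp p≡1)
... | inj₂ p≡q = p≡q

prime∤^ : ∀ {p q} → Prime p → Prime q → p ≢ q → ∀ d → ¬ p ∣ q ^ d
prime∤^ pp pq p≢q zero    p∣1 = prime≢1 pp (∣1⇒≡1 p∣1)
prime∤^ {q = q} pp pq p≢q (suc d) p∣q*q^d with euclidsLemma q (q ^ d) pp p∣q*q^d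
... | inj₁ p∣q   = p≢q (prime∣prime⇒≡ pp pq p∣q)
... | inj₂ p∣q^d = prime∤^ pp pq p≢q d p∣q^d

prime∤* : ∀ {p m n} → Prime p → ¬ p ∣ m → ¬ p ∣ n → ¬ p ∣ m * n
prime∤* {m = m} {n} pp p∤m p∤n p∣m*n with euclidsLemma m n pp p∣m*n
... | inj₁ p∣m = p∤m p∣m
... | inj₂ p∣n = p∤n p∣n

prime∤⇒coprime : ∀ {p m} → Prime p → ¬ p ∣ m → Coprime m p
prime∤⇒coprime pp p∤m {i} (i∣m , i∣p) with prime⇒irreducible pp i∣p
... | inj₁ i≡1 = i≡1
... | inj₂ refl = ⊥-elim (p∤m i∣m)

^-monoʳ-∣ : ∀ p {i c} → i ≤ c → p ^ i ∣ p ^ c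
^-monoʳ-∣ p {i} {c} i≤c =
  subst (p ^ i ∣_) (trans (sym (ℕP.^-distribˡ-+-* p i (c ∸ i))) (cong (p ^_) (ℕP.m+[n∸m]≡n i≤c)))
        (m∣m*n (p ^ (c ∸ i)))

divisor-split : ∀ {p} → Prime p → ∀ c m X → m ∣ p ^ c * X →
                Σ[ i ∈ ℕ ] (i ≤ c × Σ[ k ∈ ℕ ] (k ∣ X × m ≡ p ^ i * k))
divisor-split pp zero m X m∣X = 0 , z≤n , m , subst (m ∣_) (ℕP.*-identityˡ X) m∣X , sym (ℕP.*-identityˡ m)
divisor-split {p} pp (suc c) m X m∣ with p ∣? m
... | yes (divides m′ refl)
  with divisor-split pp c m′ X
         (*-cancelˡ-∣ p {{prime⇒nonZero pp}} (subst₂ _∣_ (ℕP.*-comm m′ p) (ℕP.*-assoc p (p ^ c) X) m∣))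
...   | i , i≤c , k , k∣X , refl =
  suc i , s≤s i≤c , k , k∣X , trans (ℕP.*-comm (p ^ i * k) p) (sym (ℕP.*-assoc p (p ^ i) k))
divisor-split {p} pp (suc c) m X m∣ | no p∤m
  with divisor-split pp c m X (coprime-divisor (prime∤⇒coprime pp p∤m) (subst (m ∣_) (ℕP.*-assoc p (p ^ c) X) m∣))
...   | i , i≤c , rest = i , ℕP.m≤n⇒m≤1+n i≤c , rest

p^i*k-injective : ∀ {p} → Prime p → ∀ i i′ {k k′} → ¬ p ∣ k → ¬ p ∣ k′ →
                  p ^ i * k ≡ p ^ i′ * k′ → i ≡ i′ × k ≡ k′
p^i*k-injective pp zero zero {k} {k′} _ _ eq = refl , trans (sym (ℕP.*-identityˡ k)) (trans eq (ℕP.*-identityˡ k′))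
p^i*k-injective {p} pp zero (suc i′) {k} {k′} p∤k _ eq = ⊥-elim (p∤k p∣k)
  where p∣k : p ∣ k
        p∣k = divides (p ^ i′ * k′)
                (trans (sym (ℕP.*-identityˡ k)) (trans eq (trans (ℕP.*-assoc p (p ^ i′) k′) (ℕP.*-comm p _))))
p^i*k-injective pp (suc i) zero p∤k p∤k′ eq with p^i*k-injective pp zero (suc i) p∤k′ p∤k (sym eq)
... | () , _
p^i*k-injective {p} pp (suc i) (suc i′) {k} {k′} p∤k p∤k′ eq
  with p^i*k-injective pp i i′ p∤k p∤k′
         (ℕP.*-cancelˡ-≡ (p ^ i * k) (p ^ i′ * k′) p {{prime⇒nonZero pp}}
            (trans (sym (ℕP.*-assoc p (p ^ i) k)) (trans eq (ℕP.*-assoc p (p ^ i′) k′))))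
... | refl , refl = refl , refl

divisorSum-p^c* : ∀ {p} → Prime p → ∀ c X → .{{NonZero X}} → ¬ p ∣ X → ∀ g →
                  divisorSum g (p ^ c * X) ≡ sumTo c (λ i → divisorSum (λ k → g (p ^ i * k)) X)
divisorSum-p^c* {p} pp c X p∤X g = begin
  sum (map g (divisors (p ^ c * X)))     ≡⟨ ℕLP.sum-↭ (PermP.map⁺ g same-elements) ⟩
  sum (map g (map split pairs))          ≡⟨ cong sum (LP.map-∘ pairs) ⟨
  sum (map (g ∘ split) pairs)            ≡⟨ sum-cartesianProduct (g ∘ split) (upTo (suc c)) (divisors X) ⟩
  sumTo c (λ i → divisorSum (λ k → g (p ^ i * k)) X) ∎
  where
  open ≡-Reasoning
  instance
    _ = ℕP.m*n≢0 (p ^ c) X {{prime^-nonZero pp c}}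
  split : ℕ × ℕ → ℕ
  split (i , k) = p ^ i * k
  pairs : List (ℕ × ℕ)
  pairs = cartesianProduct (upTo (suc c)) (divisors X)
  p∤divisor : ∀ {k} → k ∈ divisors X → ¬ p ∣ k
  p∤divisor k∈ p∣k = p∤X (∣-trans p∣k (∈-divisors⁻ k∈))
  split-injective : ∀ {x y} → x ∈ pairs → y ∈ pairs → split x ≡ split y → x ≡ y
  split-injective {i , k} {i′ , k′} x∈ y∈ eq
    with p^i*k-injective pp i i′ (p∤divisor (proj₂ (∈-cartesianProduct⁻ (upTo (suc c)) (divisors X) x∈)))
                                 (p∤divisor (proj₂ (∈-cartesianProduct⁻ (upTo (suc c)) (divisors X) y∈))) eq
  ... | refl , refl = refl
  to : ∀ {m} → m ∈ divisors (p ^ c * X) → m ∈ map split pairs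
  to m∈ with divisor-split pp c _ X (∈-divisors⁻ m∈)
  ... | i , i≤c , k , k∣X , refl =
    ∈-map⁺ split (∈-cartesianProduct⁺ (∈-upTo⁺ (s≤s i≤c)) (∈-divisors⁺ k∣X))
  from : ∀ {m} → m ∈ map split pairs → m ∈ divisors (p ^ c * X)
  from m∈ with ∈-map⁻ split m∈
  ... | (i , k) , ik∈ , refl with ∈-cartesianProduct⁻ (upTo (suc c)) (divisors X) ik∈
  ...   | i∈ , k∈ with ∈-upTo⁻ i∈
  ...     | s≤s i≤c = ∈-divisors⁺ (*-pres-∣ (^-monoʳ-∣ p i≤c) (∈-divisors⁻ k∈))
  pairs-unique : Unique pairs
  pairs-unique = UniqueP.cartesianProduct⁺ (UniqueP.upTo⁺ (suc c)) (divisors-unique X)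
  same-elements = ∼bag⇒↭ (unique∧set⇒bag (divisors-unique (p ^ c * X))
                                         (Unique-map⁺ split pairs-unique split-injective)
                                         (mk⇔ to from))

divisorSum-p^c : ∀ {p} → Prime p → ∀ c g → divisorSum g (p ^ c) ≡ sumTo c (λ i → g (p ^ i))
divisorSum-p^c {p} pp c g = begin
  divisorSum g (p ^ c)                                   ≡⟨ cong (divisorSum g) (ℕP.*-identityʳ (p ^ c)) ⟨
  divisorSum g (p ^ c * 1)                               ≡⟨ divisorSum-p^c* pp c 1 (prime≢1 pp ∘ ∣1⇒≡1) g ⟩
  sumTo c (λ i → divisorSum (λ k → g (p ^ i * k)) 1)     ≡⟨ cong sum (LP.map-cong at-one (upTo (suc c))) ⟩
  sumTo c (λ i → g (p ^ i))                              ∎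
  where open ≡-Reasoning
        at-one : ∀ i → divisorSum (λ k → g (p ^ i * k)) 1 ≡ g (p ^ i)
        at-one i = trans (ℕP.+-identityʳ (g (p ^ i * 1))) (cong g (ℕP.*-identityʳ (p ^ i)))

-- Three primes

module ThreePrimes (p q r : ℕ) (pp : Prime p) (pq : Prime q) (pr : Prime r)
                   (p≢q : p ≢ q) (q≢r : q ≢ r) (p≢r : p ≢ r) where

  q^d*r^e-nonZero : ∀ d e → NonZero (q ^ d * r ^ e)
  q^d*r^e-nonZero d e = ℕP.m*n≢0 (q ^ d) (r ^ e) {{prime^-nonZero pq d}} {{prime^-nonZero pr e}}

  A : ℕ → ℕ → ℕ → ℤ
  A c d e = pos (a (p ^ c * (q ^ d * r ^ e)))

  divisorSum-p^c*q^d*r^e : ∀ g c d e → divisorSum g (p ^ c * (q ^ d * r ^ e))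
                           ≡ sumTo c (λ i → sumTo d (λ j → sumTo e (λ k → g (p ^ i * (q ^ j * r ^ k)))))
  divisorSum-p^c*q^d*r^e g c d e =
    trans (divisorSum-p^c* pp c (q ^ d * r ^ e) {{q^d*r^e-nonZero d e}} p∤q^d*r^e g)
          (cong sum (LP.map-cong over-q (upTo (suc c))))
    where
    p∤q^d*r^e : ¬ p ∣ q ^ d * r ^ e
    p∤q^d*r^e = prime∤* pp (prime∤^ pp pq p≢q d) (prime∤^ pp pr p≢r e)
    over-q : ∀ i → divisorSum (λ k → g (p ^ i * k)) (q ^ d * r ^ e)
                   ≡ sumTo d (λ j → sumTo e (λ k → g (p ^ i * (q ^ j * r ^ k))))
    over-q i =
      trans (divisorSum-p^c* pq d (r ^ e) {{prime^-nonZero pr e}} (prime∤^ pq pr q≢r e) (λ k → g (p ^ i * k)))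
            (cong sum (LP.map-cong over-r (upTo (suc d))))
      where over-r : ∀ j → divisorSum (λ k → g (p ^ i * (q ^ j * k))) (r ^ e)
                           ≡ sumTo e (λ k → g (p ^ i * (q ^ j * r ^ k)))
            over-r j = divisorSum-p^c pr e (λ k → g (p ^ i * (q ^ j * k)))

  A-box : ∀ c d e → A c d e ⊕ A c d e ≡ pos 1 ⊕ box A c d e
  A-box c d e = begin
    pos (a N) ⊕ pos (a N)         ≡⟨ ℤP.pos-+ (a N) (a N) ⟨
    pos (a N + a N)               ≡⟨ cong pos (a+a≡1+divisorSum N {{N-nonZero}}) ⟩
    pos (1 + divisorSum a N)      ≡⟨ ℤP.pos-+ 1 (divisorSum a N) ⟩
    pos 1 ⊕ pos (divisorSum a N)  ≡⟨ cong (λ s → pos 1 ⊕ pos s) (divisorSum-p^c*q^d*r^e a c d e) ⟩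
    pos 1 ⊕ pos (sumTo c (λ i → sumTo d (λ j → sumTo e (λ k → a (p ^ i * (q ^ j * r ^ k))))))
                                  ≡⟨ cong (pos 1 ⊕_) (pos-sumTo³ c d e (λ i j k → a (p ^ i * (q ^ j * r ^ k)))) ⟩
    pos 1 ⊕ box A c d e           ∎
    where
    open ≡-Reasoning
    N = p ^ c * (q ^ d * r ^ e)
    N-nonZero : NonZero N
    N-nonZero = ℕP.m*n≢0 (p ^ c) (q ^ d * r ^ e) {{prime^-nonZero pp c}} {{q^d*r^e-nonZero d e}}

  A-solves : ∀ c d e → pos 2 ⊛ Δ₃ A c d e ≡ A c d e ⊕ δ₃ c d e
  A-solves = box-solves A A-box

  twoPrimes : ∀ c d → a (p ^ c * q ^ d) ≡ 2 ^ c * sumTo d (λ i → (d C i) * ((c + i) C i))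
  twoPrimes c d = ℤP.+-injective (begin
    pos (a (p ^ c * q ^ d))   ≡⟨ cong (λ x → pos (a (p ^ c * x))) (ℕP.*-identityʳ (q ^ d)) ⟨
    A c d 0                   ≡⟨ Δ₂-uniqueSolutions δ₂ (λ c d → A-solves c d 0) twoPrimeCount-solves c d ⟩
    twoPrimeCount c d         ≡⟨ cong (pos (2 ^ c) ⊛_) pos-binomialSum ⟨
    pos (2 ^ c) ⊛ pos (sumTo d (λ i → (d C i) * ((c + i) C i)))
                              ≡⟨ ℤP.pos-* (2 ^ c) _ ⟨
    pos (2 ^ c * sumTo d (λ i → (d C i) * ((c + i) C i))) ∎)
    where
    open ≡-Reasoning
    pos-binomialSum : pos (sumTo d (λ i → (d C i) * ((c + i) C i))) ≡ binomialSum c d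
    pos-binomialSum = trans (pos-sumTo d _) (Σℤ-cong d (λ i → ℤP.pos-* (d C i) ((c + i) C i)))

  onePrime : ∀ c → a (p ^ c) ≡ 2 ^ c
  onePrime c = begin
    a (p ^ c)         ≡⟨ cong a (ℕP.*-identityʳ (p ^ c)) ⟨
    a (p ^ c * q ^ 0) ≡⟨ twoPrimes c 0 ⟩
    2 ^ c * 1         ≡⟨ ℕP.*-identityʳ (2 ^ c) ⟩
    2 ^ c             ∎
    where open ≡-Reasoning

  threePrimes : ∀ c d e → ℤ.+ a (p ^ c * q ^ d * r ^ e)
    ≡ sumToℤ d (λ j → sign j ℤ.* ℤ.+ ((d C j) * ((c + d ∸ j) C d) * a (p ^ (c + d ∸ j) * r ^ e)))
  threePrimes c d e = begin
    pos (a (p ^ c * q ^ d * r ^ e))   ≡⟨ cong (pos ∘ a) (ℕP.*-assoc (p ^ c) (q ^ d) (r ^ e)) ⟩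
    A c d e                           ≡⟨ Δ₃-uniqueSolutions δ₃ A-solves (T-solves slice slice-solves) c d e ⟩
    T (λ m → A m 0 e) c d             ≡⟨ Σℤ-cong d term ⟩
    Σℤ d (λ j → sign j ℤ.* ℤ.+ ((d C j) * ((c + d ∸ j) C d) * a (p ^ (c + d ∸ j) * r ^ e)))
                                      ≡⟨ sumToℤ≡Σℤ d _ ⟨
    sumToℤ d (λ j → sign j ℤ.* ℤ.+ ((d C j) * ((c + d ∸ j) C d) * a (p ^ (c + d ∸ j) * r ^ e))) ∎
    where
    open ≡-Reasoning
    slice : ℕ → ℕ → ℤ
    slice m e = A m 0 e
    slice-solves : ∀ m e → pos 2 ⊛ Δ₂ slice m e ≡ slice m e ⊕ δ₂ m e
    slice-solves m zero    = A-solves m 0 0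
    slice-solves m (suc e) = A-solves m 0 (suc e)
    term : ∀ j → T-coefficient c d j ⊛ A (c + d ∸ j) 0 e
               ≡ sign j ℤ.* ℤ.+ ((d C j) * ((c + d ∸ j) C d) * a (p ^ (c + d ∸ j) * r ^ e))
    term j = begin
      (sign j ⊛ pos b) ⊛ pos (a (p ^ m * (1 * r ^ e)))
        ≡⟨ cong (λ x → (sign j ⊛ pos b) ⊛ pos (a (p ^ m * x))) (ℕP.*-identityˡ (r ^ e)) ⟩
      (sign j ⊛ pos b) ⊛ pos (a (p ^ m * r ^ e))
        ≡⟨ ℤP.*-assoc (sign j) (pos b) _ ⟩
      sign j ⊛ (pos b ⊛ pos (a (p ^ m * r ^ e)))
        ≡⟨ cong (sign j ⊛_) (ℤP.pos-* b (a (p ^ m * r ^ e))) ⟨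
      sign j ⊛ pos (b * a (p ^ m * r ^ e)) ∎
      where m = c + d ∸ j
            b = (d C j) * (m C d)

theorem5 : (p q r : ℕ) → Prime p → Prime q → Prime r →
    p ≢ q → q ≢ r → p ≢ r → (c d e : ℕ) →
      (a (p ^ c) ≡ 2 ^ c)
      × (a (p ^ c * q ^ d) ≡ 2 ^ c * sumTo d (λ i → (d C i) * ((c + i) C i)))
      × (ℤ.+ a (p ^ c * q ^ d * r ^ e)
          ≡ sumToℤ d (λ j → sign j ℤ.* ℤ.+ ((d C j) * ((c + d ∸ j) C d) * a (p ^ (c + d ∸ j) * r ^ e))))
theorem5 p q r pp pq pr p≢q q≢r p≢r c d e = onePrime c , twoPrimes c d , threePrimes c d e
  where open ThreePrimes p q r pp pq pr p≢q q≢r p≢r
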